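{- Let $N_2$ be a positive rational number and let $(X_2,Y_2)$ and $(Z_2,W_2)$ be rational points on the curve $C_{N_2}: y^2=x^3-N_2^2x$ with $Y_2\neq 0$, $W_2\neq 0$, $X_2\neq Z_2$, and such that $X_2Z_2$ is the square of a rational number; let $\sqrt{X_2Z_2}$ denote its positive square root. (i) For every positive rational number $a$, the numbers $$b=\Big|\frac{2Y_2W_2}{(X_2-Z_2)(N_2^2-X_2Z_2)}\Big|\,a,\quad c=\frac{2N_2\sqrt{X_2Z_2}}{|N_2^2-X_2Z_2|}\,a,\quad d_{bc}=\frac{2\sqrt{X_2Z_2}}{|X_2-Z_2|}\,a,$$ $$d_{ac}=\frac{N_2^2+X_2Z_2}{|N_2^2-X_2Z_2|}\,a,\quad d_s=\Big|\frac{X_2+Z_2}{X_2-Z_2}\Big|\,a$$ are positive rational numbers and $(a,b,c,d_{bc},d_{ac},d_s)$ is a nearly-perfect cuboid; its face diagonal $d_{ab}=\sqrt{a^2+b^2}$ equals $\sqrt{1+\Big(\frac{2Y_2W_2}{(X_2-Z_2)(N_2^2-X_2Z_2)}\Big)^2}\cdot a$. (ii) Conversely, every nearly-perfect cuboid is obtained in this way for some such $N_2$, $(X_2,Y_2)$, $(Z_2,W_2)$ and $a$. (iii) In particular, a perfect cuboid exists if and only if for some such data the number $\sqrt{1+\Big(\frac{2Y_2W_2}{(X_2-Z_2)(N_2^2-X_2Z_2)}\Big)^2}\cdot a$ is rational.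
   Context: For a nonzero rational $N$, the congruent number curve is $C_N: y^2=x^3-N^2x$; a rational point $(x,y)$ on it is called nontrivial if $y\neq 0$. A nearly-perfect cuboid (NPC) here means a sextuple of positive rational numbers $(a,b,c,d_{bc},d_{ac},d_s)$ with $b^2+c^2=d_{bc}^2$, $a^2+c^2=d_{ac}^2$, $a^2+b^2+c^2=d_s^2$ (the remaining face diagonal $d_{ab}=\sqrt{a^2+b^2}$ may be irrational). A perfect cuboid is a triple of positive rationals $a,b,c$ such that $a^2+b^2$, $b^2+c^2$, $a^2+c^2$ and $a^2+b^2+c^2$ are all squares of rational numbers. -}

module Defs where

open import Data.Rational using (ℚ; 0ℚ; 1ℚ; _+_; _*_; _-_; _÷_; ∣_∣; _<_; ≢-nonZero)
open import Data.Rational.Properties using (_≟_)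
open import Data.Product using (_×_; ∃; Σ-syntax; ∃-syntax)
open import Relation.Binary.PropositionalEquality using (_≡_; _≢_)
open import Relation.Nullary using (yes; no)

2ℚ : ℚ
2ℚ = 1ℚ + 1ℚ

-- Total division: p / q for q ≢ 0, and (by convention) 0 when q ≡ 0.
-- Under the hypotheses of the theorem all denominators used are nonzero.
_÷'_ : ℚ → ℚ → ℚ
p ÷' q with q ≟ 0ℚ
... | yes _  = 0ℚ
... | no q≢0 = _÷_ p q {{≢-nonZero q≢0}}

infixl 7 _÷'_

sq : ℚ → ℚ
sq x = x * x

IsSquare : ℚ → Set
IsSquare q = ∃[ r ] (r * r ≡ q)

OnCurve : ℚ → ℚ → ℚ → Set
OnCurve N x y = y * y ≡ x * x * x - N * N * x

Admissible : ℚ → ℚ → ℚ → ℚ → ℚ → ℚ → Set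
Admissible N X Y Z W s =
  0ℚ < N × OnCurve N X Y × OnCurve N Z W × Y ≢ 0ℚ × W ≢ 0ℚ × X ≢ Z
  × 0ℚ < s × s * s ≡ X * Z

kF : ℚ → ℚ → ℚ → ℚ → ℚ → ℚ
kF N X Y Z W = (2ℚ * Y * W) ÷' ((X - Z) * (N * N - X * Z))

bF : ℚ → ℚ → ℚ → ℚ → ℚ → ℚ → ℚ
bF N X Y Z W a = ∣ kF N X Y Z W ∣ * a

cF : ℚ → ℚ → ℚ → ℚ → ℚ → ℚ
cF N X Z s a = ((2ℚ * N * s) ÷' ∣ N * N - X * Z ∣) * a

dbcF : ℚ → ℚ → ℚ → ℚ → ℚ
dbcF X Z s a = ((2ℚ * s) ÷' ∣ X - Z ∣) * a

dacF : ℚ → ℚ → ℚ → ℚ → ℚ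
dacF N X Z a = ((N * N + X * Z) ÷' ∣ N * N - X * Z ∣) * a

dsF : ℚ → ℚ → ℚ → ℚ
dsF X Z a = ∣ (X + Z) ÷' (X - Z) ∣ * a

NPC : ℚ → ℚ → ℚ → ℚ → ℚ → ℚ → Set
NPC a b c dbc dac ds =
  0ℚ < a × 0ℚ < b × 0ℚ < c × 0ℚ < dbc × 0ℚ < dac × 0ℚ < ds
  × b * b + c * c ≡ dbc * dbc
  × a * a + c * c ≡ dac * dac
  × a * a + b * b + c * c ≡ ds * ds

PerfectCuboid : ℚ → ℚ → ℚ → Set
PerfectCuboid a b c =
  0ℚ < a × 0ℚ < b × 0ℚ < c
  × IsSquare (a * a + b * b) × IsSquare (b * b + c * c)
  × IsSquare (a * a + c * c) × IsSquare (a * a + b * b + c * c)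

-- Put P = X − Z and D = N² − XZ. Multiplying the curve equations of (X,Y) and (Z,W) and
-- using s² = XZ gives (YW)² + (sNP)² = (sD)², so (2YW/PD, 2Ns/D, 2s/P) is a Pythagorean
-- triple; with the parametrisations P² + (2s)² = (X + Z)² and D² + (2Ns)² = (N² + XZ)²
-- these are exactly the relations of a nearly-perfect cuboid with a = 1, and (i) follows
-- by scaling. Conversely the cuboid determines the curve data up to a common factor, which
-- is chosen to make X³ − N²X a square, and then W is forced by b. For (iii), d_ab is the
-- only missing diagonal, and d_ab² = (1 + k²) a².

module Submission where

open import Defs
open import Data.Rational using (ℚ; 0ℚ; 1ℚ; _+_; _*_; _<_)
open import Data.Product using (_×_; ∃; Σ-syntax; ∃-syntax)
open import Relation.Binary.PropositionalEquality using (_≡_)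

open import Data.Rational using (_-_; -_; ∣_∣; _≤_; 1/_; positive; ≢-nonZero)
open import Data.Rational.Properties
open import Data.Rational.Solver using (module +-*-Solver)
open import Algebra.Properties.Group +-0-group using (∙-cancelʳ; x∙y⁻¹≈ε⇒x≈y; x≈y⇒x∙y⁻¹≈ε)
open import Algebra.Apartness.Properties.HeytingCommutativeRing heytingCommutativeRing
  using (x#0y#0→xy#0)
open import Data.Product using (_,_)
open import Data.Sum using (inj₁; inj₂)
open import Function.Base using (_∘_)
open import Function.Bundles using (_⇔_; mk⇔; Equivalence)
open import Relation.Binary.PropositionalEquality
  using (refl; sym; trans; cong; cong₂; subst; subst₂; _≢_; ≢-sym; module ≡-Reasoning)
open import Relation.Binary.Definitions using (tri<; tri≈; tri>)
open import Relation.Nullary using (yes; no; contradiction)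

open ≡-Reasoning

open +-*-Solver using (solve; _:+_; _:*_; _:-_; :-_; _:=_; con)

0<⇒≢0 : ∀ {p} → 0ℚ < p → p ≢ 0ℚ
0<⇒≢0 0<p = ≢-sym (<⇒≢ 0<p)

0<2 : 0ℚ < 2ℚ
0<2 = positive⁻¹ 2ℚ

*-pos : ∀ {p q} → 0ℚ < p → 0ℚ < q → 0ℚ < p * q
*-pos {p} {q} 0<p 0<q = positive⁻¹ (p * q) {{pos*pos⇒pos p {{positive 0<p}} q {{positive 0<q}}}}

∣p∣*∣p∣≡p*p : ∀ p → ∣ p ∣ * ∣ p ∣ ≡ p * p
∣p∣*∣p∣≡p*p p with ∣p∣≡p∨∣p∣≡-p p
... | inj₁ ∣p∣≡p  = cong (λ q → q * q) ∣p∣≡p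
... | inj₂ ∣p∣≡-p = trans (cong (λ q → q * q) ∣p∣≡-p) (neg-square p)
  where
  neg-square : ∀ p → - p * - p ≡ p * p
  neg-square = solve 1 (λ p → :- p :* :- p := p :* p) refl

0≤∧≢0⇒0< : ∀ {p} → 0ℚ ≤ p → p ≢ 0ℚ → 0ℚ < p
0≤∧≢0⇒0< {p} 0≤p p≢0 with <-cmp 0ℚ p
... | tri< 0<p _ _ = 0<p
... | tri≈ _ 0≡p _ = contradiction (sym 0≡p) p≢0
... | tri> _ _ p<0 = contradiction (≤-<-trans 0≤p p<0) (<-irrefl refl)

0<∣p∣ : ∀ {p} → p ≢ 0ℚ → 0ℚ < ∣ p ∣
0<∣p∣ {p} p≢0 = 0≤∧≢0⇒0< (0≤∣p∣ p) (p≢0 ∘ ∣p∣≡0⇒p≡0 p)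

0<p*p : ∀ {p} → p ≢ 0ℚ → 0ℚ < p * p
0<p*p {p} p≢0 = subst (0ℚ <_) (∣p∣*∣p∣≡p*p p) (*-pos (0<∣p∣ p≢0) (0<∣p∣ p≢0))

0≤p*p : ∀ p → 0ℚ ≤ p * p
0≤p*p p = subst (0ℚ ≤_) (∣p∣*∣p∣≡p*p p)
  (nonNegative⁻¹ _ {{nonNeg*nonNeg⇒nonNeg (∣ p ∣) {{∣-∣-nonNeg p}} (∣ p ∣) {{∣-∣-nonNeg p}}}})

*-cancelʳ-≡ : ∀ p q {r} → r ≢ 0ℚ → p * r ≡ q * r → p ≡ q
*-cancelʳ-≡ p q {r} r≢0 pr≡qr = begin
  p                ≡⟨ cancel p ⟩
  (p * r) * 1/ r   ≡⟨ cong (_* 1/ r) pr≡qr ⟩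
  (q * r) * 1/ r   ≡⟨ cancel q ⟨
  q                ∎
  where
  instance _ = ≢-nonZero r≢0
  cancel : ∀ x → x ≡ (x * r) * 1/ r
  cancel x = begin
    x              ≡⟨ *-identityʳ x ⟨
    x * 1ℚ         ≡⟨ cong (x *_) (*-inverseʳ r) ⟨
    x * (r * 1/ r) ≡⟨ *-assoc x r (1/ r) ⟨
    (x * r) * 1/ r ∎

p÷'q*q≡p : ∀ p {q} → q ≢ 0ℚ → (p ÷' q) * q ≡ p
p÷'q*q≡p p {q} q≢0 with q ≟ 0ℚ
... | yes q≡0 = contradiction q≡0 q≢0
... | no _ = begin
  (p * 1/ q) * q ≡⟨ *-assoc p (1/ q) q ⟩
  p * (1/ q * q) ≡⟨ cong (p *_) (*-inverseˡ q) ⟩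
  p * 1ℚ         ≡⟨ *-identityʳ p ⟩
  p              ∎
  where instance _ = ≢-nonZero q≢0

x*q≡p*a⇒x≡p÷'q*a : ∀ {x} p {q} a → q ≢ 0ℚ → x * q ≡ p * a → x ≡ (p ÷' q) * a
x*q≡p*a⇒x≡p÷'q*a {x} p {q} a q≢0 x*q≡p*a = *-cancelʳ-≡ x ((p ÷' q) * a) q≢0 (begin
  x * q                ≡⟨ x*q≡p*a ⟩
  p * a                ≡⟨ cong (_* a) (p÷'q*q≡p p q≢0) ⟨
  ((p ÷' q) * q) * a   ≡⟨ swap (p ÷' q) q a ⟩
  ((p ÷' q) * a) * q   ∎)
  where
  swap : ∀ x y z → (x * y) * z ≡ (x * z) * y
  swap = solve 3 (λ x y z → (x :* y) :* z := (x :* z) :* y) refl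

÷'-≢0 : ∀ {p q} → p ≢ 0ℚ → q ≢ 0ℚ → p ÷' q ≢ 0ℚ
÷'-≢0 {p} {q} p≢0 q≢0 p÷'q≡0 = p≢0 (begin
  p             ≡⟨ p÷'q*q≡p p q≢0 ⟨
  (p ÷' q) * q  ≡⟨ cong (_* q) p÷'q≡0 ⟩
  0ℚ * q        ≡⟨ *-zeroˡ q ⟩
  0ℚ            ∎)

0<÷' : ∀ {p q} → 0ℚ < p → 0ℚ < q → 0ℚ < p ÷' q
0<÷' {p} {q} 0<p 0<q with q ≟ 0ℚ
... | yes q≡0 = contradiction q≡0 (0<⇒≢0 0<q)
... | no q≢0 = *-pos 0<p (positive⁻¹ _ {{1/pos⇒pos q {{positive 0<q}}}})

0<p*q⇒p*q≡∣p∣*q : ∀ {p q} → 0ℚ < q → 0ℚ < p * q → p * q ≡ ∣ p ∣ * q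
0<p*q⇒p*q≡∣p∣*q {p} {q} 0<q 0<pq = begin
  p * q          ≡⟨ 0≤p⇒∣p∣≡p (<⇒≤ 0<pq) ⟨
  ∣ p * q ∣      ≡⟨ ∣p*q∣≡∣p∣*∣q∣ p q ⟩
  ∣ p ∣ * ∣ q ∣  ≡⟨ cong (∣ p ∣ *_) (0≤p⇒∣p∣≡p (<⇒≤ 0<q)) ⟩
  ∣ p ∣ * q      ∎

-- x = ± p / q: all that the squared cuboid relations see of a ratio, so signs and
-- absolute values in the formulas for the edges never need to be tracked.
record SquareRatio (x p q : ℚ) : Set where
  constructor squareRatio
  field x²q²≡p² : x * x * (q * q) ≡ p * p

x*q≡p⇒SquareRatio : ∀ x q {p} → x * q ≡ p → SquareRatio x p q
x*q≡p⇒SquareRatio x q {p} x*q≡p = squareRatio (trans (regroup x q) (cong (λ t → t * t) x*q≡p))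
  where
  regroup : ∀ x q → x * x * (q * q) ≡ (x * q) * (x * q)
  regroup = solve 2 (λ x q → x :* x :* (q :* q) := (x :* q) :* (x :* q)) refl

÷'-SquareRatio : ∀ p {q} → q ≢ 0ℚ → SquareRatio (p ÷' q) p q
÷'-SquareRatio p {q} q≢0 = x*q≡p⇒SquareRatio (p ÷' q) q (p÷'q*q≡p p q≢0)

SquareRatio-1 : ∀ q → SquareRatio 1ℚ q q
SquareRatio-1 q = x*q≡p⇒SquareRatio 1ℚ q (*-identityˡ q)

SquareRatio-scale : ∀ x a → SquareRatio x (x * a) a
SquareRatio-scale x a = x*q≡p⇒SquareRatio x a refl

SquareRatio-∣∣ : ∀ {x p q} → SquareRatio x p q → SquareRatio ∣ x ∣ p q
SquareRatio-∣∣ {x} {p} {q} (squareRatio h) =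
  squareRatio (subst (λ t → t * (q * q) ≡ p * p) (sym (∣p∣*∣p∣≡p*p x)) h)

SquareRatio-∣∣-denominator : ∀ {x p q} → SquareRatio x p ∣ q ∣ → SquareRatio x p q
SquareRatio-∣∣-denominator {x} {p} {q} (squareRatio h) =
  squareRatio (subst (λ t → x * x * t ≡ p * p) (∣p∣*∣p∣≡p*p q) h)

SquareRatio-*ˡ : ∀ {x p q} r → SquareRatio x p q → SquareRatio x (r * p) (r * q)
SquareRatio-*ˡ {x} {p} {q} r (squareRatio x²q²≡p²) = squareRatio (begin
  x * x * ((r * q) * (r * q))   ≡⟨ regroup x q r ⟩
  (r * r) * (x * x * (q * q))   ≡⟨ cong ((r * r) *_) x²q²≡p² ⟩
  (r * r) * (p * p)             ≡⟨ regroup′ r p ⟩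
  (r * p) * (r * p)             ∎)
  where
  regroup : ∀ x q r → x * x * ((r * q) * (r * q)) ≡ (r * r) * (x * x * (q * q))
  regroup = solve 3 (λ x q r →
    x :* x :* ((r :* q) :* (r :* q))
      := (r :* r) :* (x :* x :* (q :* q))) refl
  regroup′ : ∀ r p → (r * r) * (p * p) ≡ (r * p) * (r * p)
  regroup′ = solve 2 (λ r p → (r :* r) :* (p :* p) := (r :* p) :* (r :* p)) refl

SquareRatio-*ʳ : ∀ {x p q} r → SquareRatio x p q → SquareRatio x (p * r) (q * r)
SquareRatio-*ʳ {x} {p} {q} r =
  subst₂ (SquareRatio x) (*-comm r p) (*-comm r q) ∘ SquareRatio-*ˡ r

SquareRatio-sum : ∀ {x y u v q} → SquareRatio x u q → SquareRatio y v q →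
  (x * x + y * y) * (q * q) ≡ u * u + v * v
SquareRatio-sum {x} {y} {q = q} (squareRatio hx) (squareRatio hy) =
  trans (*-distribʳ-+ (q * q) (x * x) (y * y)) (cong₂ _+_ hx hy)

pythagorean-scale : ∀ {x y z u v w q} →
  SquareRatio x u q → SquareRatio y v q → SquareRatio z w q →
  x * x + y * y ≡ z * z → u * u + v * v ≡ w * w
pythagorean-scale {q = q} hx hy (squareRatio hz) x²+y²≡z² =
  trans (sym (SquareRatio-sum hx hy)) (trans (cong (_* (q * q)) x²+y²≡z²) hz)

pythagorean-unscale : ∀ {x y z u v w q} → q ≢ 0ℚ →
  SquareRatio x u q → SquareRatio y v q → SquareRatio z w q →
  u * u + v * v ≡ w * w → x * x + y * y ≡ z * z
pythagorean-unscale {x} {y} {z} q≢0 hx hy (squareRatio hz) u²+v²≡w² =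
  *-cancelʳ-≡ (x * x + y * y) (z * z) (x#0y#0→xy#0 q≢0 q≢0)
    (trans (SquareRatio-sum hx hy) (trans u²+v²≡w² (sym hz)))

hypotenuse-≢0 : ∀ x {y z} → y ≢ 0ℚ → x * x + y * y ≡ z * z → z ≢ 0ℚ
hypotenuse-≢0 x {y} {z} y≢0 x²+y²≡z² z≡0 = <-irrefl (sym z²≡0) 0<z²
  where
  0<z² : 0ℚ < z * z
  0<z² = subst (0ℚ <_) x²+y²≡z² (+-mono-≤-< (0≤p*p x) (0<p*p y≢0))
  z²≡0 : z * z ≡ 0ℚ
  z²≡0 = trans (cong (λ t → t * t) z≡0) (*-zeroˡ 0ℚ)

pythagorean-parametrisation : ∀ u v t → t * t ≡ u * v →
  (u - v) * (u - v) + (2ℚ * t) * (2ℚ * t) ≡ (u + v) * (u + v)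
pythagorean-parametrisation u v t t²≡uv = begin
  (u - v) * (u - v) + (2ℚ * t) * (2ℚ * t)   ≡⟨ expand u v t ⟩
  (u - v) * (u - v) + 2ℚ * 2ℚ * (t * t)     ≡⟨ cong (λ w → (u - v) * (u - v) + 2ℚ * 2ℚ * w) t²≡uv ⟩
  (u - v) * (u - v) + 2ℚ * 2ℚ * (u * v)     ≡⟨ square-sum u v ⟩
  (u + v) * (u + v)                         ∎
  where
  expand : ∀ u v t → (u - v) * (u - v) + (2ℚ * t) * (2ℚ * t) ≡ (u - v) * (u - v) + 2ℚ * 2ℚ * (t * t)
  expand = solve 3 (λ u v t →
    (u :- v) :* (u :- v) :+ (con 2ℚ :* t) :* (con 2ℚ :* t)
      := (u :- v) :* (u :- v) :+ con 2ℚ :* con 2ℚ :* (t :* t)) refl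
  square-sum : ∀ u v → (u - v) * (u - v) + 2ℚ * 2ℚ * (u * v) ≡ (u + v) * (u + v)
  square-sum = solve 2 (λ u v →
    (u :- v) :* (u :- v) :+ con 2ℚ :* con 2ℚ :* (u :* v)
      := (u :+ v) :* (u :+ v)) refl

hypotenuse-shift : ∀ x y a → x * x ≡ a * a + y * y → (x + a) * (x + a) ≡ y * y + 2ℚ * a * (x + a)
hypotenuse-shift x y a x²≡a²+y² = begin
  (x + a) * (x + a)                   ≡⟨ expand x a ⟩
  x * x + a * (2ℚ * x + a)            ≡⟨ cong (_+ a * (2ℚ * x + a)) x²≡a²+y² ⟩
  a * a + y * y + a * (2ℚ * x + a)    ≡⟨ regroup x y a ⟩
  y * y + 2ℚ * a * (x + a)            ∎
  where
  expand : ∀ x a → (x + a) * (x + a) ≡ x * x + a * (2ℚ * x + a)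
  expand = solve 2 (λ x a → (x :+ a) :* (x :+ a) := x :* x :+ a :* (con 2ℚ :* x :+ a)) refl
  regroup : ∀ x y a → a * a + y * y + a * (2ℚ * x + a) ≡ y * y + 2ℚ * a * (x + a)
  regroup = solve 3 (λ x y a →
    a :* a :+ y :* y :+ a :* (con 2ℚ :* x :+ a)
      := y :* y :+ con 2ℚ :* a :* (x :+ a)) refl

curve-product : ∀ N X Z →
  (X * X * X - N * N * X) * (Z * Z * Z - N * N * Z) + (X * Z) * (N * N * ((X - Z) * (X - Z)))
    ≡ (X * Z) * ((N * N - X * Z) * (N * N - X * Z))
curve-product = solve 3 (λ N X Z →
  (X :* X :* X :- N :* N :* X) :* (Z :* Z :* Z :- N :* N :* Z) :+ (X :* Z) :* (N :* N :* ((X :- Z) :* (X :- Z)))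
    := (X :* Z) :* ((N :* N :- X :* Z) :* (N :* N :- X :* Z))) refl

OnCurve⇔pythagorean : ∀ N X Y Z W s → s * s ≡ X * Z → OnCurve N X Y → Y ≢ 0ℚ →
  OnCurve N Z W ⇔ ((Y * W) * (Y * W) + (s * N * (X - Z)) * (s * N * (X - Z))
                     ≡ (s * (N * N - X * Z)) * (s * (N * N - X * Z)))
OnCurve⇔pythagorean N X Y Z W s s²≡XZ onX Y≢0 = mk⇔ to from
  where
  R = (s * N * (X - Z)) * (s * N * (X - Z))
  T = (s * (N * N - X * Z)) * (s * (N * N - X * Z))
  split : ∀ Y W → (Y * W) * (Y * W) ≡ (W * W) * (Y * Y)
  split = solve 2 (λ Y W → (Y :* W) :* (Y :* W) := (W :* W) :* (Y :* Y)) refl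
  key : (Z * Z * Z - N * N * Z) * (Y * Y) + R ≡ T
  key = begin
    (Z * Z * Z - N * N * Z) * (Y * Y) + R
      ≡⟨ regroup N X Y Z s ⟩
    (Y * Y) * (Z * Z * Z - N * N * Z) + (s * s) * (N * N * ((X - Z) * (X - Z)))
      ≡⟨ cong₂ (λ u v → u * (Z * Z * Z - N * N * Z) + v * (N * N * ((X - Z) * (X - Z)))) onX s²≡XZ ⟩
    (X * X * X - N * N * X) * (Z * Z * Z - N * N * Z) + (X * Z) * (N * N * ((X - Z) * (X - Z)))
      ≡⟨ curve-product N X Z ⟩
    (X * Z) * ((N * N - X * Z) * (N * N - X * Z))
      ≡⟨ cong (_* ((N * N - X * Z) * (N * N - X * Z))) s²≡XZ ⟨
    (s * s) * ((N * N - X * Z) * (N * N - X * Z))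
      ≡⟨ regroup′ s (N * N - X * Z) ⟩
    T ∎
    where
    regroup : ∀ N X Y Z s → (Z * Z * Z - N * N * Z) * (Y * Y) + (s * N * (X - Z)) * (s * N * (X - Z))
      ≡ (Y * Y) * (Z * Z * Z - N * N * Z) + (s * s) * (N * N * ((X - Z) * (X - Z)))
    regroup = solve 5 (λ N X Y Z s →
      (Z :* Z :* Z :- N :* N :* Z) :* (Y :* Y) :+ (s :* N :* (X :- Z)) :* (s :* N :* (X :- Z))
        := (Y :* Y) :* (Z :* Z :* Z :- N :* N :* Z) :+ (s :* s) :* (N :* N :* ((X :- Z) :* (X :- Z)))) refl
    regroup′ : ∀ s D → (s * s) * (D * D) ≡ (s * D) * (s * D)
    regroup′ = solve 2 (λ s D → (s :* s) :* (D :* D) := (s :* D) :* (s :* D)) refl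
  to : W * W ≡ Z * Z * Z - N * N * Z → (Y * W) * (Y * W) + R ≡ T
  to onZ = trans (cong (_+ R) (trans (split Y W) (cong (_* (Y * Y)) onZ))) key
  from : (Y * W) * (Y * W) + R ≡ T → W * W ≡ Z * Z * Z - N * N * Z
  from pyth = *-cancelʳ-≡ (W * W) _ (x#0y#0→xy#0 Y≢0 Y≢0)
    (∙-cancelʳ R _ _ (trans (cong (_+ R) (sym (split Y W))) (trans pyth (sym key))))

NPC-scale : ∀ {β γ δ ε σ} a → 0ℚ < a →
  0ℚ < β → 0ℚ < γ → 0ℚ < δ → 0ℚ < ε → 0ℚ < σ →
  β * β + γ * γ ≡ δ * δ → 1ℚ + γ * γ ≡ ε * ε → 1ℚ + δ * δ ≡ σ * σ →
  NPC a (β * a) (γ * a) (δ * a) (ε * a) (σ * a)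
NPC-scale {β} {γ} {δ} {ε} {σ} a 0<a 0<β 0<γ 0<δ 0<ε 0<σ β²+γ²≡δ² 1+γ²≡ε² 1+δ²≡σ² =
  0<a , *-pos 0<β 0<a , *-pos 0<γ 0<a , *-pos 0<δ 0<a , *-pos 0<ε 0<a , *-pos 0<σ 0<a ,
  face-bc , pythagorean-scale (SquareRatio-1 a) (SquareRatio-scale γ a) (SquareRatio-scale ε a) 1+γ²≡ε² ,
  trans (+-assoc (a * a) _ _)
    (trans (cong (a * a +_) face-bc)
      (pythagorean-scale (SquareRatio-1 a) (SquareRatio-scale δ a) (SquareRatio-scale σ a) 1+δ²≡σ²))
  where
  face-bc : (β * a) * (β * a) + (γ * a) * (γ * a) ≡ (δ * a) * (δ * a)
  face-bc = pythagorean-scale (SquareRatio-scale β a) (SquareRatio-scale γ a) (SquareRatio-scale δ a) β²+γ²≡δ²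

face-diagonal : ∀ k a → a * a + (∣ k ∣ * a) * (∣ k ∣ * a) ≡ (1ℚ + k * k) * (a * a)
face-diagonal k a = begin
  a * a + (∣ k ∣ * a) * (∣ k ∣ * a)     ≡⟨ SquareRatio-sum (SquareRatio-1 a) (SquareRatio-scale ∣ k ∣ a) ⟨
  (1ℚ + ∣ k ∣ * ∣ k ∣) * (a * a)        ≡⟨ cong (λ t → (1ℚ + t) * (a * a)) (∣p∣*∣p∣≡p*p k) ⟩
  (1ℚ + k * k) * (a * a)                ∎

Admissible⇒NPC : ∀ {N X Y Z W s} → Admissible N X Y Z W s → ∀ {a} → 0ℚ < a →
  NPC a (bF N X Y Z W a) (cF N X Z s a) (dbcF X Z s a) (dacF N X Z a) (dsF X Z a)
Admissible⇒NPC {N} {X} {Y} {Z} {W} {s} (0<N , onX , onZ , Y≢0 , W≢0 , X≢Z , 0<s , s²≡XZ) {a} 0<a =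
  NPC-scale a 0<a (0<∣p∣ k≢0) 0<γ 0<δ 0<ε (0<∣p∣ ρ≢0) ∣k∣²+γ²≡δ² 1+γ²≡ε² 1+δ²≡∣ρ∣²
  where
  P = X - Z
  D = N * N - X * Z
  k = kF N X Y Z W
  γ = (2ℚ * N * s) ÷' ∣ D ∣
  δ = (2ℚ * s) ÷' ∣ P ∣
  ε = (N * N + X * Z) ÷' ∣ D ∣
  ρ = (X + Z) ÷' P

  s≢0 = 0<⇒≢0 0<s
  P≢0 : P ≢ 0ℚ
  P≢0 = X≢Z ∘ x∙y⁻¹≈ε⇒x≈y X Z
  pyth : (Y * W) * (Y * W) + (s * N * P) * (s * N * P) ≡ (s * D) * (s * D)
  pyth = Equivalence.to (OnCurve⇔pythagorean N X Y Z W s s²≡XZ onX Y≢0) onZ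
  D≢0 : D ≢ 0ℚ
  D≢0 D≡0 = hypotenuse-≢0 (Y * W) (x#0y#0→xy#0 (x#0y#0→xy#0 s≢0 (0<⇒≢0 0<N)) P≢0) pyth
    (trans (cong (s *_) D≡0) (*-zeroʳ s))
  PD≢0 = x#0y#0→xy#0 P≢0 D≢0
  k≢0 : k ≢ 0ℚ
  k≢0 = ÷'-≢0 (x#0y#0→xy#0 (x#0y#0→xy#0 (0<⇒≢0 0<2) Y≢0) W≢0) PD≢0

  γ-ratio : SquareRatio γ (2ℚ * N * s) D
  γ-ratio = SquareRatio-∣∣-denominator (÷'-SquareRatio _ (0<⇒≢0 (0<∣p∣ D≢0)))
  δ-ratio : SquareRatio δ (2ℚ * s) P
  δ-ratio = SquareRatio-∣∣-denominator (÷'-SquareRatio _ (0<⇒≢0 (0<∣p∣ P≢0)))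

  ∣k∣²+γ²≡δ² : ∣ k ∣ * ∣ k ∣ + γ * γ ≡ δ * δ
  ∣k∣²+γ²≡δ² = pythagorean-unscale PD≢0
    (SquareRatio-∣∣ (÷'-SquareRatio _ PD≢0)) (SquareRatio-*ˡ P γ-ratio) (SquareRatio-*ʳ D δ-ratio)
    (begin
      (2ℚ * Y * W) * (2ℚ * Y * W) + (P * (2ℚ * N * s)) * (P * (2ℚ * N * s))
        ≡⟨ regroup Y W N s P ⟩
      2ℚ * 2ℚ * ((Y * W) * (Y * W) + (s * N * P) * (s * N * P))
        ≡⟨ cong (2ℚ * 2ℚ *_) pyth ⟩
      2ℚ * 2ℚ * ((s * D) * (s * D))
        ≡⟨ regroup′ s D ⟩
      (2ℚ * s * D) * (2ℚ * s * D) ∎)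
    where
    regroup : ∀ Y W N s P → (2ℚ * Y * W) * (2ℚ * Y * W) + (P * (2ℚ * N * s)) * (P * (2ℚ * N * s))
      ≡ 2ℚ * 2ℚ * ((Y * W) * (Y * W) + (s * N * P) * (s * N * P))
    regroup = solve 5 (λ Y W N s P →
      (con 2ℚ :* Y :* W) :* (con 2ℚ :* Y :* W) :+ (P :* (con 2ℚ :* N :* s)) :* (P :* (con 2ℚ :* N :* s))
        := con 2ℚ :* con 2ℚ :* ((Y :* W) :* (Y :* W) :+ (s :* N :* P) :* (s :* N :* P))) refl
    regroup′ : ∀ s D → 2ℚ * 2ℚ * ((s * D) * (s * D)) ≡ (2ℚ * s * D) * (2ℚ * s * D)
    regroup′ = solve 2 (λ s D →
      con 2ℚ :* con 2ℚ :* ((s :* D) :* (s :* D))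
        := (con 2ℚ :* s :* D) :* (con 2ℚ :* s :* D)) refl

  1+γ²≡ε² : 1ℚ + γ * γ ≡ ε * ε
  1+γ²≡ε² = pythagorean-unscale D≢0 (SquareRatio-1 D) γ-ratio
    (SquareRatio-∣∣-denominator (÷'-SquareRatio _ (0<⇒≢0 (0<∣p∣ D≢0))))
    (trans (cong (λ t → D * D + t * t) (*-assoc 2ℚ N s))
      (pythagorean-parametrisation (N * N) (X * Z) (N * s) (trans (regroup N s) (cong (N * N *_) s²≡XZ))))
    where
    regroup : ∀ N s → (N * s) * (N * s) ≡ N * N * (s * s)
    regroup = solve 2 (λ N s → (N :* s) :* (N :* s) := N :* N :* (s :* s)) refl

  1+δ²≡∣ρ∣² : 1ℚ + δ * δ ≡ ∣ ρ ∣ * ∣ ρ ∣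
  1+δ²≡∣ρ∣² = pythagorean-unscale P≢0 (SquareRatio-1 P) δ-ratio
    (SquareRatio-∣∣ (÷'-SquareRatio _ P≢0)) (pythagorean-parametrisation X Z s s²≡XZ)

  ρ≢0 : ρ ≢ 0ℚ
  ρ≢0 = ÷'-≢0 (hypotenuse-≢0 P (x#0y#0→xy#0 (0<⇒≢0 0<2) s≢0) (pythagorean-parametrisation X Z s s²≡XZ)) P≢0

  0<γ : 0ℚ < γ
  0<γ = 0<÷' (*-pos (*-pos 0<2 0<N) 0<s) (0<∣p∣ D≢0)
  0<δ : 0ℚ < δ
  0<δ = 0<÷' (*-pos 0<2 0<s) (0<∣p∣ P≢0)
  0<ε : 0ℚ < ε
  0<ε = 0<÷' (+-mono-< (0<p*p (0<⇒≢0 0<N)) (subst (0ℚ <_) s²≡XZ (0<p*p s≢0))) (0<∣p∣ D≢0)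

NPC-from-curve-point : ∀ {a b c dbc dac ds N X Y Z s} →
  0ℚ < a → 0ℚ < b → 0ℚ < ds → b * b + c * c ≡ dbc * dbc →
  0ℚ < N → OnCurve N X Y → Y ≢ 0ℚ → 0ℚ < s → s * s ≡ X * Z →
  X - Z ≢ 0ℚ → N * N - X * Z ≢ 0ℚ →
  c * ∣ N * N - X * Z ∣ ≡ 2ℚ * N * s * a → dac * ∣ N * N - X * Z ∣ ≡ (N * N + X * Z) * a →
  dbc * ∣ X - Z ∣ ≡ 2ℚ * s * a → ds * (X - Z) ≡ (X + Z) * a →
  ∃[ W ] (Admissible N X Y Z W s
    × b ≡ bF N X Y Z W a × c ≡ cF N X Z s a × dbc ≡ dbcF X Z s a
    × dac ≡ dacF N X Z a × ds ≡ dsF X Z a)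
NPC-from-curve-point {a} {b} {c} {dbc} {dac} {ds} {N} {X} {Y} {Z} {s}
  0<a 0<b 0<ds b²+c²≡dbc² 0<N onX Y≢0 0<s s²≡XZ P≢0 D≢0 c-rel dac-rel dbc-rel ds-rel =
  W , (0<N , onX , onZ , Y≢0 , W≢0 , P≢0 ∘ x≈y⇒x∙y⁻¹≈ε , 0<s , s²≡XZ) ,
  positive-scaling k 0<b (x*q≡p*a⇒x≡p÷'q*a (2ℚ * Y * W) a PD≢0 b-rel) ,
  x*q≡p*a⇒x≡p÷'q*a _ a ∣D∣≢0 c-rel ,
  x*q≡p*a⇒x≡p÷'q*a _ a (0<⇒≢0 (0<∣p∣ P≢0)) dbc-rel ,
  x*q≡p*a⇒x≡p÷'q*a _ a ∣D∣≢0 dac-rel ,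
  positive-scaling ρ 0<ds (x*q≡p*a⇒x≡p÷'q*a (X + Z) a P≢0 ds-rel)
  where
  P = X - Z
  D = N * N - X * Z
  2Ya≢0 = x#0y#0→xy#0 (x#0y#0→xy#0 (0<⇒≢0 0<2) Y≢0) (0<⇒≢0 0<a)
  PD≢0 = x#0y#0→xy#0 P≢0 D≢0
  ∣D∣≢0 = 0<⇒≢0 (0<∣p∣ D≢0)

  W = (b * (P * D)) ÷' (2ℚ * Y * a)
  k = kF N X Y Z W
  ρ = (X + Z) ÷' P
  W≢0 : W ≢ 0ℚ
  W≢0 = ÷'-≢0 (x#0y#0→xy#0 (0<⇒≢0 0<b) PD≢0) 2Ya≢0
  b-rel : b * (P * D) ≡ (2ℚ * Y * W) * a
  b-rel = trans (sym (p÷'q*q≡p (b * (P * D)) 2Ya≢0)) (regroup Y W a)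
    where
    regroup : ∀ Y W a → W * (2ℚ * Y * a) ≡ (2ℚ * Y * W) * a
    regroup = solve 3 (λ Y W a → W :* (con 2ℚ :* Y :* a) := (con 2ℚ :* Y :* W) :* a) refl

  positive-scaling : ∀ {x} e → 0ℚ < x → x ≡ e * a → x ≡ ∣ e ∣ * a
  positive-scaling e 0<x x≡ea = trans x≡ea (0<p*q⇒p*q≡∣p∣*q {e} 0<a (subst (0ℚ <_) x≡ea 0<x))

  scaled-pyth : ((2ℚ * Y * W) * a) * ((2ℚ * Y * W) * a) + (P * (2ℚ * N * s * a)) * (P * (2ℚ * N * s * a))
    ≡ ((2ℚ * s * a) * D) * ((2ℚ * s * a) * D)
  scaled-pyth = pythagorean-scale (x*q≡p⇒SquareRatio b (P * D) b-rel)
    (SquareRatio-*ˡ P (SquareRatio-∣∣-denominator (x*q≡p⇒SquareRatio c ∣ D ∣ c-rel)))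
    (SquareRatio-*ʳ D (SquareRatio-∣∣-denominator (x*q≡p⇒SquareRatio dbc ∣ P ∣ dbc-rel))) b²+c²≡dbc²
  pyth : (Y * W) * (Y * W) + (s * N * P) * (s * N * P) ≡ (s * D) * (s * D)
  pyth = *-cancelʳ-≡ _ _ (x#0y#0→xy#0 2a≢0 2a≢0) (begin
    ((Y * W) * (Y * W) + (s * N * P) * (s * N * P)) * ((2ℚ * a) * (2ℚ * a))  ≡⟨ regroup Y W N s P a ⟩
    _                                                                        ≡⟨ scaled-pyth ⟩
    ((2ℚ * s * a) * D) * ((2ℚ * s * a) * D)                                  ≡⟨ regroup′ s a D ⟩
    (s * D) * (s * D) * ((2ℚ * a) * (2ℚ * a))                                ∎)
    where
    2a≢0 = x#0y#0→xy#0 (0<⇒≢0 0<2) (0<⇒≢0 0<a)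
    regroup : ∀ Y W N s P a → ((Y * W) * (Y * W) + (s * N * P) * (s * N * P)) * ((2ℚ * a) * (2ℚ * a))
      ≡ ((2ℚ * Y * W) * a) * ((2ℚ * Y * W) * a) + (P * (2ℚ * N * s * a)) * (P * (2ℚ * N * s * a))
    regroup = solve 6 (λ Y W N s P a →
      ((Y :* W) :* (Y :* W) :+ (s :* N :* P) :* (s :* N :* P)) :* ((con 2ℚ :* a) :* (con 2ℚ :* a))
        := ((con 2ℚ :* Y :* W) :* a) :* ((con 2ℚ :* Y :* W) :* a) :+ (P :* (con 2ℚ :* N :* s :* a)) :* (P :* (con 2ℚ :* N :* s :* a))) refl
    regroup′ : ∀ s a D → ((2ℚ * s * a) * D) * ((2ℚ * s * a) * D) ≡ (s * D) * (s * D) * ((2ℚ * a) * (2ℚ * a))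
    regroup′ = solve 3 (λ s a D →
      ((con 2ℚ :* s :* a) :* D) :* ((con 2ℚ :* s :* a) :* D)
        := (s :* D) :* (s :* D) :* ((con 2ℚ :* a) :* (con 2ℚ :* a))) refl
  onZ : OnCurve N Z W
  onZ = Equivalence.from (OnCurve⇔pythagorean N X Y Z W s s²≡XZ onX Y≢0) pyth

-- The formulas for d_s and d_ac force X : Z = (d_s + a) : (d_s − a) and s : N = (d_ac + a) : c;
-- only the common scale K is free.
module CurvePointOfCuboid {a c dbc dac ds : ℚ}
  (0<a : 0ℚ < a) (0<c : 0ℚ < c) (0<dbc : 0ℚ < dbc) (0<dac : 0ℚ < dac) (0<ds : 0ℚ < ds)
  (ds²≡a²+dbc² : ds * ds ≡ a * a + dbc * dbc) (dac²≡a²+c² : dac * dac ≡ a * a + c * c) where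

  U = ds + a
  V = dac + a
  E = U * U * (V * V) - dbc * dbc * (c * c)
  K = E * V * U

  X = K * U * V
  Z = K * (ds - a) * V
  N = K * dbc * c
  s = K * dbc * V
  Y = K * K

  U²≡dbc²+2aU : U * U ≡ dbc * dbc + 2ℚ * a * U
  U²≡dbc²+2aU = hypotenuse-shift ds dbc a ds²≡a²+dbc²

  V²≡c²+2aV : V * V ≡ c * c + 2ℚ * a * V
  V²≡c²+2aV = hypotenuse-shift dac c a dac²≡a²+c²

  0<2aU : 0ℚ < 2ℚ * a * U
  0<2aU = *-pos (*-pos 0<2 0<a) (+-mono-< 0<ds 0<a)

  0<2aV : 0ℚ < 2ℚ * a * V
  0<2aV = *-pos (*-pos 0<2 0<a) (+-mono-< 0<dac 0<a)

  0<E : 0ℚ < E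
  0<E = subst (0ℚ <_) (sym E≡) (+-mono-< (*-pos (0<p*p (0<⇒≢0 0<dbc)) 0<2aV)
                                          (*-pos 0<2aU (+-mono-< (0<p*p (0<⇒≢0 0<c)) 0<2aV)))
    where
    expand : ∀ p q r t → (p + r) * (q + t) - p * q ≡ p * t + r * (q + t)
    expand = solve 4 (λ p q r t → (p :+ r) :* (q :+ t) :- p :* q := p :* t :+ r :* (q :+ t)) refl
    E≡ : E ≡ dbc * dbc * (2ℚ * a * V) + 2ℚ * a * U * (c * c + 2ℚ * a * V)
    E≡ = trans (cong₂ (λ u v → u * v - dbc * dbc * (c * c)) U²≡dbc²+2aU V²≡c²+2aV)
               (expand (dbc * dbc) (c * c) (2ℚ * a * U) (2ℚ * a * V))

  0<K : 0ℚ < K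
  0<K = *-pos (*-pos 0<E (+-mono-< 0<dac 0<a)) (+-mono-< 0<ds 0<a)

  0<N : 0ℚ < N
  0<N = *-pos (*-pos 0<K 0<dbc) 0<c

  0<s : 0ℚ < s
  0<s = *-pos (*-pos 0<K 0<dbc) (+-mono-< 0<dac 0<a)

  Y≢0 : Y ≢ 0ℚ
  Y≢0 = x#0y#0→xy#0 (0<⇒≢0 0<K) (0<⇒≢0 0<K)

  -- X³ − N²X = K³ · UVE, and K = EVU is chosen to make this the square K⁴.
  onX : OnCurve N X Y
  onX = sym (begin
    X * X * X - N * N * X                            ≡⟨ factor K U V dbc c ⟩
    (K * K * K) * ((U * U * (V * V) - dbc * dbc * (c * c)) * V * U) ≡⟨ fourth-power K ⟩
    Y * Y                                            ∎)
    where
    factor : ∀ K U V d c → (K * U * V) * (K * U * V) * (K * U * V) - (K * d * c) * (K * d * c) * (K * U * V)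
      ≡ (K * K * K) * ((U * U * (V * V) - d * d * (c * c)) * V * U)
    factor = solve 5 (λ K U V d c →
      (K :* U :* V) :* (K :* U :* V) :* (K :* U :* V) :- (K :* d :* c) :* (K :* d :* c) :* (K :* U :* V)
        := (K :* K :* K) :* ((U :* U :* (V :* V) :- d :* d :* (c :* c)) :* V :* U)) refl
    fourth-power : ∀ K → (K * K * K) * K ≡ (K * K) * (K * K)
    fourth-power = solve 1 (λ K → (K :* K :* K) :* K := (K :* K) :* (K :* K)) refl

  s²≡XZ : s * s ≡ X * Z
  s²≡XZ = sym (begin
    X * Z                                           ≡⟨ factor K ds a V ⟩
    (K * V) * (K * V) * (ds * ds - a * a)           ≡⟨ cong (λ t → (K * V) * (K * V) * (t - a * a)) ds²≡a²+dbc² ⟩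
    (K * V) * (K * V) * ((a * a + dbc * dbc) - a * a) ≡⟨ cancel K V a dbc ⟩
    s * s                                           ∎)
    where
    factor : ∀ K ds a V → (K * (ds + a) * V) * (K * (ds - a) * V) ≡ (K * V) * (K * V) * (ds * ds - a * a)
    factor = solve 4 (λ K ds a V →
      (K :* (ds :+ a) :* V) :* (K :* (ds :- a) :* V)
        := (K :* V) :* (K :* V) :* (ds :* ds :- a :* a)) refl
    cancel : ∀ K V a d → (K * V) * (K * V) * ((a * a + d * d) - a * a) ≡ (K * d * V) * (K * d * V)
    cancel = solve 4 (λ K V a d →
      (K :* V) :* (K :* V) :* ((a :* a :+ d :* d) :- a :* a)
        := (K :* d :* V) :* (K :* d :* V)) refl

  X-Z≡2aKV : X - Z ≡ 2ℚ * a * (K * V)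
  X-Z≡2aKV = difference K ds a V
    where
    difference : ∀ K ds a V → K * (ds + a) * V - K * (ds - a) * V ≡ 2ℚ * a * (K * V)
    difference = solve 4 (λ K ds a V →
      K :* (ds :+ a) :* V :- K :* (ds :- a) :* V
        := con 2ℚ :* a :* (K :* V)) refl

  0<X-Z : 0ℚ < X - Z
  0<X-Z = subst (0ℚ <_) (sym X-Z≡2aKV) (*-pos (*-pos 0<2 0<a) (*-pos 0<K (+-mono-< 0<dac 0<a)))

  S = K * K * (dbc * dbc) * (2ℚ * a * V)

  N²-XZ≡-S : N * N - X * Z ≡ - S
  N²-XZ≡-S = begin
    N * N - X * Z                                          ≡⟨ cong (λ t → N * N - t) s²≡XZ ⟨
    N * N - s * s                                          ≡⟨ factor K dbc c V ⟩
    - (K * K * (dbc * dbc) * (V * V - c * c))              ≡⟨ cong (λ t → - (K * K * (dbc * dbc) * (t - c * c))) V²≡c²+2aV ⟩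
    - (K * K * (dbc * dbc) * ((c * c + 2ℚ * a * V) - c * c)) ≡⟨ cancel (K * K * (dbc * dbc)) (c * c) (2ℚ * a * V) ⟩
    - S                                                    ∎
    where
    factor : ∀ K d c V → (K * d * c) * (K * d * c) - (K * d * V) * (K * d * V) ≡ - (K * K * (d * d) * (V * V - c * c))
    factor = solve 4 (λ K d c V →
      (K :* d :* c) :* (K :* d :* c) :- (K :* d :* V) :* (K :* d :* V)
        := :- (K :* K :* (d :* d) :* (V :* V :- c :* c))) refl
    cancel : ∀ t u w → - (t * ((u + w) - u)) ≡ - (t * w)
    cancel = solve 3 (λ t u w → :- (t :* ((u :+ w) :- u)) := :- (t :* w)) refl

  0<S : 0ℚ < S
  0<S = *-pos (*-pos (*-pos 0<K 0<K) (0<p*p (0<⇒≢0 0<dbc))) 0<2aV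

  ∣N²-XZ∣≡S : ∣ N * N - X * Z ∣ ≡ S
  ∣N²-XZ∣≡S = trans (cong ∣_∣ N²-XZ≡-S) (trans (∣-p∣≡∣p∣ S) (0≤p⇒∣p∣≡p (<⇒≤ 0<S)))

  N²-XZ≢0 : N * N - X * Z ≢ 0ℚ
  N²-XZ≢0 N²-XZ≡0 = 0<⇒≢0 0<S (trans (sym ∣N²-XZ∣≡S) (cong ∣_∣ N²-XZ≡0))

  c-rel : c * ∣ N * N - X * Z ∣ ≡ 2ℚ * N * s * a
  c-rel = trans (cong (c *_) ∣N²-XZ∣≡S) (regroup c K dbc a V)
    where
    regroup : ∀ c K d a V → c * (K * K * (d * d) * (2ℚ * a * V)) ≡ 2ℚ * (K * d * c) * (K * d * V) * a
    regroup = solve 5 (λ c K d a V →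
      c :* (K :* K :* (d :* d) :* (con 2ℚ :* a :* V))
        := con 2ℚ :* (K :* d :* c) :* (K :* d :* V) :* a) refl

  dac-rel : dac * ∣ N * N - X * Z ∣ ≡ (N * N + X * Z) * a
  dac-rel = begin
    dac * ∣ N * N - X * Z ∣                                            ≡⟨ cong (dac *_) ∣N²-XZ∣≡S ⟩
    dac * S                                                            ≡⟨ regroup K dbc a dac ⟩
    K * K * (dbc * dbc) * (dac * dac + dac * dac + 2ℚ * a * dac) * a
      ≡⟨ cong (λ t → K * K * (dbc * dbc) * (t + dac * dac + 2ℚ * a * dac) * a) dac²≡a²+c² ⟩
    K * K * (dbc * dbc) * ((a * a + c * c) + dac * dac + 2ℚ * a * dac) * a ≡⟨ regroup′ K dbc c dac a ⟩
    (N * N + s * s) * a                                                ≡⟨ cong (λ t → (N * N + t) * a) s²≡XZ ⟩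
    (N * N + X * Z) * a                                                ∎
    where
    regroup : ∀ K d a dac → dac * (K * K * (d * d) * (2ℚ * a * (dac + a)))
      ≡ K * K * (d * d) * (dac * dac + dac * dac + 2ℚ * a * dac) * a
    regroup = solve 4 (λ K d a dac →
      dac :* (K :* K :* (d :* d) :* (con 2ℚ :* a :* (dac :+ a)))
        := K :* K :* (d :* d) :* (dac :* dac :+ dac :* dac :+ con 2ℚ :* a :* dac) :* a) refl
    regroup′ : ∀ K d c dac a → K * K * (d * d) * ((a * a + c * c) + dac * dac + 2ℚ * a * dac) * a
      ≡ ((K * d * c) * (K * d * c) + (K * d * (dac + a)) * (K * d * (dac + a))) * a
    regroup′ = solve 5 (λ K d c dac a →
      K :* K :* (d :* d) :* ((a :* a :+ c :* c) :+ dac :* dac :+ con 2ℚ :* a :* dac) :* a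
        := ((K :* d :* c) :* (K :* d :* c) :+ (K :* d :* (dac :+ a)) :* (K :* d :* (dac :+ a))) :* a) refl

  dbc-rel : dbc * ∣ X - Z ∣ ≡ 2ℚ * s * a
  dbc-rel = begin
    dbc * ∣ X - Z ∣          ≡⟨ cong (dbc *_) (0≤p⇒∣p∣≡p (<⇒≤ 0<X-Z)) ⟩
    dbc * (X - Z)            ≡⟨ cong (dbc *_) X-Z≡2aKV ⟩
    dbc * (2ℚ * a * (K * V)) ≡⟨ regroup dbc a K V ⟩
    2ℚ * s * a               ∎
    where
    regroup : ∀ d a K V → d * (2ℚ * a * (K * V)) ≡ 2ℚ * (K * d * V) * a
    regroup = solve 4 (λ d a K V →
      d :* (con 2ℚ :* a :* (K :* V))
        := con 2ℚ :* (K :* d :* V) :* a) refl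

  ds-rel : ds * (X - Z) ≡ (X + Z) * a
  ds-rel = regroup K ds a V
    where
    regroup : ∀ K ds a V → ds * (K * (ds + a) * V - K * (ds - a) * V) ≡ (K * (ds + a) * V + K * (ds - a) * V) * a
    regroup = solve 4 (λ K ds a V →
      ds :* (K :* (ds :+ a) :* V :- K :* (ds :- a) :* V)
        := (K :* (ds :+ a) :* V :+ K :* (ds :- a) :* V) :* a) refl

NPC⇒Admissible : (a b c dbc dac ds : ℚ) → NPC a b c dbc dac ds →
  ∃[ N ] ∃[ X ] ∃[ Y ] ∃[ Z ] ∃[ W ] ∃[ s ] (Admissible N X Y Z W s
    × b ≡ bF N X Y Z W a × c ≡ cF N X Z s a × dbc ≡ dbcF X Z s a
    × dac ≡ dacF N X Z a × ds ≡ dsF X Z a)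
NPC⇒Admissible a b c dbc dac ds
  (0<a , 0<b , 0<c , 0<dbc , 0<dac , 0<ds , b²+c²≡dbc² , a²+c²≡dac² , a²+b²+c²≡ds²) =
  let W , facts = NPC-from-curve-point 0<a 0<b 0<ds b²+c²≡dbc² 0<N onX Y≢0 0<s s²≡XZ
                    (0<⇒≢0 0<X-Z) N²-XZ≢0 c-rel dac-rel dbc-rel ds-rel
  in N , X , Y , Z , W , s , facts
  where
  ds²≡a²+dbc² : ds * ds ≡ a * a + dbc * dbc
  ds²≡a²+dbc² = begin
    ds * ds                 ≡⟨ a²+b²+c²≡ds² ⟨
    a * a + b * b + c * c   ≡⟨ +-assoc (a * a) (b * b) (c * c) ⟩
    a * a + (b * b + c * c) ≡⟨ cong (a * a +_) b²+c²≡dbc² ⟩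
    a * a + dbc * dbc       ∎
  open CurvePointOfCuboid 0<a 0<c 0<dbc 0<dac 0<ds ds²≡a²+dbc² (sym a²+c²≡dac²)

positive-root : ∀ {q} → IsSquare q → 0ℚ < q → ∃[ r ] (0ℚ < r × q ≡ r * r)
positive-root {q} (r , r²≡q) 0<q = ∣ r ∣ , 0<∣p∣ r≢0 , trans (sym r²≡q) (sym (∣p∣*∣p∣≡p*p r))
  where
  r≢0 : r ≢ 0ℚ
  r≢0 r≡0 = 0<⇒≢0 0<q (trans (sym r²≡q) (cong (λ t → t * t) r≡0))

PerfectCuboid⇔NPC : ∀ {a b c} → PerfectCuboid a b c ⇔
  ((∃[ dbc ] ∃[ dac ] ∃[ ds ] NPC a b c dbc dac ds) × IsSquare (a * a + b * b))
PerfectCuboid⇔NPC {a} {b} {c} = mk⇔ to from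
  where
  to : PerfectCuboid a b c → (∃[ dbc ] ∃[ dac ] ∃[ ds ] NPC a b c dbc dac ds) × IsSquare (a * a + b * b)
  to (0<a , 0<b , 0<c , ab-square , bc-square , ac-square , abc-square) =
    let 0<a² = 0<p*p (0<⇒≢0 0<a)
        0<b² = 0<p*p (0<⇒≢0 0<b)
        0<c² = 0<p*p (0<⇒≢0 0<c)
        dbc , 0<dbc , bc≡ = positive-root bc-square (+-mono-< 0<b² 0<c²)
        dac , 0<dac , ac≡ = positive-root ac-square (+-mono-< 0<a² 0<c²)
        ds  , 0<ds  , abc≡ = positive-root abc-square (+-mono-< (+-mono-< 0<a² 0<b²) 0<c²)
    in (dbc , dac , ds , 0<a , 0<b , 0<c , 0<dbc , 0<dac , 0<ds , bc≡ , ac≡ , abc≡) , ab-square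
  from : (∃[ dbc ] ∃[ dac ] ∃[ ds ] NPC a b c dbc dac ds) × IsSquare (a * a + b * b) → PerfectCuboid a b c
  from ((dbc , dac , ds , 0<a , 0<b , 0<c , _ , _ , _ , bc≡ , ac≡ , abc≡) , ab-square) =
    0<a , 0<b , 0<c , ab-square , (dbc , sym bc≡) , (dac , sym ac≡) , (ds , sym abc≡)

theorem5 :
    ((N X Y Z W s : ℚ) → Admissible N X Y Z W s → (a : ℚ) → 0ℚ < a →
        NPC a (bF N X Y Z W a) (cF N X Z s a) (dbcF X Z s a) (dacF N X Z a) (dsF X Z a)
        × a * a + bF N X Y Z W a * bF N X Y Z W a ≡ (1ℚ + kF N X Y Z W * kF N X Y Z W) * (a * a))
    × ((a b c dbc dac ds : ℚ) → NPC a b c dbc dac ds →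
        ∃[ N ] ∃[ X ] ∃[ Y ] ∃[ Z ] ∃[ W ] ∃[ s ] (Admissible N X Y Z W s
          × b ≡ bF N X Y Z W a × c ≡ cF N X Z s a × dbc ≡ dbcF X Z s a
          × dac ≡ dacF N X Z a × ds ≡ dsF X Z a))
    × (((∃[ a ] ∃[ b ] ∃[ c ] PerfectCuboid a b c) →
          ∃[ N ] ∃[ X ] ∃[ Y ] ∃[ Z ] ∃[ W ] ∃[ s ] ∃[ a ] (Admissible N X Y Z W s × 0ℚ < a
            × IsSquare ((1ℚ + kF N X Y Z W * kF N X Y Z W) * (a * a))))
      × ((∃[ N ] ∃[ X ] ∃[ Y ] ∃[ Z ] ∃[ W ] ∃[ s ] ∃[ a ] (Admissible N X Y Z W s × 0ℚ < a
            × IsSquare ((1ℚ + kF N X Y Z W * kF N X Y Z W) * (a * a))))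
          → ∃[ a ] ∃[ b ] ∃[ c ] PerfectCuboid a b c))
theorem5 =
  (λ N X Y Z W s adm a 0<a → Admissible⇒NPC adm 0<a , face-diagonal (kF N X Y Z W) a) ,
  NPC⇒Admissible ,
  (λ { (a , b , c , perfect) →
    let (dbc , dac , ds , npc@(0<a , _)) , (r , r²≡a²+b²) = Equivalence.to PerfectCuboid⇔NPC perfect
        N , X , Y , Z , W , s , adm , b≡bF , _ = NPC⇒Admissible a b c dbc dac ds npc
    in N , X , Y , Z , W , s , a , adm , 0<a ,
       (r , trans r²≡a²+b² (trans (cong (λ t → a * a + t * t) b≡bF) (face-diagonal (kF N X Y Z W) a))) }) ,
  (λ { (N , X , Y , Z , W , s , a , adm , 0<a , (r , r²≡[1+k²]a²)) →
    a , bF N X Y Z W a , cF N X Z s a ,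
    Equivalence.from PerfectCuboid⇔NPC
      ((_ , _ , _ , Admissible⇒NPC adm 0<a) ,
       (r , trans r²≡[1+k²]a² (sym (face-diagonal (kF N X Y Z W) a)))) })
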